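{- For each $n\in\mathbb{N}$, the class of languages accepted by register set automata with at most $n$ registers is closed under union, and is not closed under intersection and not closed under complement.
   Context: $\mathbb{N}$ denotes the positive integers. Fix a finite nonempty alphabet $\Sigma$ and an infinite data domain $\mathbb{D}$. A register set automaton (RsA) is a tuple $(Q,R,\Delta,I,F)$ with $Q$ finite states, $R$ finite registers, $I,F\subseteq Q$, and transitions $q\xrightarrow{a\mid G^{\in},G^{\notin},up}s$ with $a\in\Sigma$, $G^{\in},G^{\notin}\subseteq R$ disjoint, $up\colon R\to 2^{R\cup\{\mathit{in}\}}$. Configurations are $(q,f)$ with $f\colon R\to 2^{\mathbb{D}}$; initial ones have $q\in I$ and all registers empty. A step over $(a,d)$ is possible iff $d\in f(r)$ for all $r\in G^{\in}$ and $d\notin f(r)$ for all $r\in G^{\notin}$; afterwards each register $r$ holds $\bigcup\{f(r')\mid r'\in R\cap up(r)\}$, plus $d$ if $\mathit{in}\in up(r)$. $L(\mathcal{A})\subseteq(\Sigma\times\mathbb{D})^*$ is the set of words with a run from an initial configuration ending in $F$. Complement is taken with respect to $(\Sigma\times\mathbb{D})^*$. -}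

module Defs where

open import Level using (0ℓ)
open import Data.Nat using (ℕ; _≤_)
open import Data.Fin using (Fin)
open import Data.Fin.Subset using (Subset; _∈_; _∉_)
open import Data.Bool using (Bool; true)
open import Data.List using (List)
open import Data.Product using (Σ; ∃; _×_; _,_)
open import Data.Sum using (_⊎_)
open import Data.Empty using (⊥)
import Data.List.Membership.Propositional as LM
open import Relation.Binary.PropositionalEquality using (_≡_)

Word : Set → Set → Set
Word A D = List (A × D)

Language : Set → Set → Set₂
Language A D = Word A D → Set₁

-- The update  up : R → 2^(R ∪ {in})
-- is given by  up r ⊆ R  and the flag  upIn r  (whether in ∈ up(r)).
record Trans (A : Set) (nq m : ℕ) : Set where
  field
    src  : Fin nq
    lab  : A
    gin  : Subset m
    gout : Subset m
    disj : ∀ r → r ∈ gin → r ∉ gout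
    up   : Fin m → Subset m
    upIn : Fin m → Bool
    tgt  : Fin nq

record RsA (A : Set) (m : ℕ) : Set where
  field
    nq    : ℕ
    Δ     : List (Trans A nq m)
    I     : Subset nq
    F     : Subset nq

Regs : Set → ℕ → Set₁
Regs D m = Fin m → D → Set

emptyRegs : ∀ {D m} → Regs D m
emptyRegs _ _ = ⊥

module _ {A D : Set} {nq m : ℕ} where
  Enabled : Trans A nq m → Regs D m → D → Set
  Enabled t f d = (∀ r → r ∈ Trans.gin t → f r d)
                × (∀ r → r ∈ Trans.gout t → f r d → ⊥)

  update : Trans A nq m → Regs D m → D → Regs D m
  update t f d r e =
    (∃ λ r' → r' ∈ Trans.up t r × f r' e) ⊎ (Trans.upIn t r ≡ true × e ≡ d)

data Run {A D : Set} {m : ℕ} (𝒜 : RsA A m)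
     : Fin (RsA.nq 𝒜) → Regs D m → Word A D → Fin (RsA.nq 𝒜) → Set₁ where
  done : ∀ {q f} → Run 𝒜 q f Data.List.[] q
  step : ∀ {q f a d w q'} (t : Trans A (RsA.nq 𝒜) m) →
         LM._∈_ t (RsA.Δ 𝒜) → Trans.src t ≡ q → Trans.lab t ≡ a →
         Enabled t f d →
         Run 𝒜 (Trans.tgt t) (update t f d) w q' →
         Run 𝒜 q f (Data.List._∷_ (a , d) w) q'

Lang : {A : Set} (D : Set) {m : ℕ} → RsA A m → Language A D
Lang D 𝒜 w = ∃ λ q → q ∈ RsA.I 𝒜 × ∃ λ q' → q' ∈ RsA.F 𝒜 × Run {D = D} 𝒜 q emptyRegs w q'

_≐_ : {A D : Set} → Language A D → Language A D → Set₁
L ≐ K = ∀ w → (L w → K w) × (K w → L w)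

_∪L_ : {A D : Set} → Language A D → Language A D → Language A D
(L ∪L K) w = L w ⊎ K w

_∩L_ : {A D : Set} → Language A D → Language A D → Language A D
(L ∩L K) w = L w × K w

∁L : {A D : Set} → Language A D → Language A D
∁L L w = L w → ⊥

AcceptedLeq : {A : Set} (D : Set) → ℕ → Language A D → Set₁
AcceptedLeq {A} D n L = ∃ λ m → m ≤ n × Σ (RsA A m) λ 𝒜 → L ≐ Lang D 𝒜

-- Union: pad both automata with unused registers up to n registers and run them side by side
-- on disjoint state spaces.
--
-- Non-closure: after reading a prefix, an automaton with m registers sees a datum only through
-- the set of registers containing it, so among more than 2 ^ m data two are indistinguishable,
-- and exchanging them in the rest of the word preserves acceptance.  Take M = 2 ^ n + 1 data
-- h 0, …, h (M - 1) and the words  h 0 ⋯ h (M - 1) · h (ρ 0) ⋯ h (ρ (M - 1)).  For a colouring c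
-- of positions by sets of n registers, an automaton can store each h l in the registers c l and
-- then accept exactly when c x = c (ρ x) for all x (or, dually, when this fails for some x).
-- Two colourings that together separate all M positions yield two such languages whose
-- intersection contains the word for ρ = id but none for a transposition ρ, and the complement
-- of the union of the dual languages behaves in the same way.

module Submission where

open import Defs
open import Data.Nat using (ℕ; suc; _≤_)
open import Data.Fin using (Fin)
open import Data.Product using (_×_; ∃; ∃₂)
open import Relation.Nullary using (¬_)
open import Function.Bundles using (_↔_; _↣_)

open import Data.Bool using (Bool; true; false; T)
open import Data.Nat
  using (zero; _+_; _<_; _^_; _≤ᵇ_; _≤′_; ≤′-refl; ≤′-step; z≤n; s≤s; z<s)
open import Data.Nat.Properties
  using (_≟_; ≤-refl; ≤-trans; <-trans; <-≤-trans; <⇒≤; <⇒≢; <⇒≱; ≤⇒≯; ≤∧≢⇒<; ≤⇒≤′;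
         n<1+n; n≤1+n; m<n⇒m<1+n; m≤n⇒m<n∨m≡n; m≤m+n; m≤n+m; m<m+n;
         +-identityʳ; +-suc; +-cancelʳ-≡; +-monoˡ-≤; ^-monoʳ-≤; m^n≢0; ≤ᵇ⇒≤; ≤⇒≤ᵇ)
open import Data.Nat.DivMod using (_mod_; m<n⇒m%n≡m)
open import Data.Fin
  using (zero; suc; toℕ; _↑ˡ_; _↑ʳ_; splitAt; funToFin; finToFun; combine)
open import Data.Fin.Properties
  using (splitAt-↑ˡ; splitAt-↑ʳ; splitAt⁻¹-↑ˡ; splitAt⁻¹-↑ʳ; ↑ˡ-injective; ↑ʳ-injective;
         ∀-cons; pigeonhole; toℕ<n; toℕ-fromℕ<; finToFun-funToFin; funToFin-finToFin)
open import Data.Fin.Subset using (Subset; _∈_; _∉_; outside; ⊥; ∁; ⁅_⁆; _∩_)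
open import Data.Fin.Subset.Properties
  using (_∈?_; ∉⊥; x∈⁅x⁆; x∈⁅y⁆⇒x≡y; x∈∁p⇒x∉p; x∉p⇒x∈∁p; x∈p∩q⁺; x∈p∩q⁻; ⊆-antisym)
open import Data.Vec using ([]; _∷_; here; there; tabulate; replicate; lookup; head)
  renaming (_++_ to _++ᵛ_)
open import Data.Vec.Properties
  using ([]=⇒lookup; lookup⇒[]=; lookup-++ˡ; lookup-++ʳ; lookup∘tabulate)
open import Data.Product using (_,_; proj₁; proj₂)
open import Data.Sum using (_⊎_; inj₁; inj₂; [_,_]′)
open import Data.List using (List; []; _∷_; _++_; map; iterate; cartesianProductWith; allFin)
open import Data.List.Membership.Propositional using () renaming (_∈_ to _∈ₗ_)
open import Data.List.Membership.Propositional.Properties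
  using (∈-map⁺; ∈-map⁻; ∈-++⁺ˡ; ∈-++⁺ʳ; ∈-++⁻; ∈-cartesianProductWith⁺; ∈-cartesianProductWith⁻;
         ∈-allFin)
open import Data.List.Relation.Binary.Pointwise as Pointwise using (Pointwise; []; _∷_)
open import Data.List.Relation.Unary.All as All using (All; []; _∷_)
open import Data.List.Relation.Unary.Any as Any using (Any; here; there)
open import Function using (id; const; _∘_)
open import Function.Bundles using (_⇔_; mk⇔; Equivalence; Inverse; Injection)
open import Function.Construct.Identity using (⇔-id)
open import Function.Construct.Symmetry using (⇔-sym)
open import Function.Definitions using (Injective)
open import Relation.Binary.PropositionalEquality
  using (_≡_; _≢_; refl; sym; trans; cong; cong₂; subst; ≢-sym)
open import Relation.Nullary using (Dec; yes; no; contradiction)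
open import Relation.Nullary.Decidable using (¬¬-excluded-middle; decidable-stable)
open import Relation.Nullary.Negation using (¬¬-map)

open Equivalence using (to; from)
open Trans
open RsA

-- Transporting runs

EqualityPreserving : {D : Set} → (D → D → Set) → Set
EqualityPreserving _~_ = ∀ {d d' e e'} → d ~ d' → e ~ e' → (d ≡ e ⇔ d' ≡ e')

RegsRelated : {D : Set} {m : ℕ} → (D → D → Set) → Regs D m → Regs D m → Set
RegsRelated _~_ f g = ∀ r {e e'} → e ~ e' → (f r e ⇔ g r e')

WordsRelated : {A D : Set} → (D → D → Set) → Word A D → Word A D → Set
WordsRelated _~_ = Pointwise (λ (a , d) (a' , d') → a ≡ a' × d ~ d')

module _ {A D : Set} {m : ℕ} (𝒜 : RsA A m) {_~_ : D → D → Set}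
         (~-preserves-≡ : EqualityPreserving _~_) where

  enabled-related : ∀ (t : Trans A (nq 𝒜) m) {f g d d'} → d ~ d' → RegsRelated _~_ f g →
                    Enabled t f d → Enabled t g d'
  enabled-related t d~d' f~g (ins , outs) =
    (λ r r∈ → to (f~g r d~d') (ins r r∈)) ,
    (λ r r∈ g-r-d' → outs r r∈ (from (f~g r d~d') g-r-d'))

  update-related : ∀ (t : Trans A (nq 𝒜) m) {f g d d'} → d ~ d' → RegsRelated _~_ f g →
                   RegsRelated _~_ (update t f d) (update t g d')
  update-related t d~d' f~g r e~e' = mk⇔
    (λ { (inj₁ (s , s∈ , f-s-e)) → inj₁ (s , s∈ , to (f~g s e~e') f-s-e)
       ; (inj₂ (new , e≡d)) → inj₂ (new , to (~-preserves-≡ e~e' d~d') e≡d) })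
    (λ { (inj₁ (s , s∈ , g-s-e')) → inj₁ (s , s∈ , from (f~g s e~e') g-s-e')
       ; (inj₂ (new , e'≡d')) → inj₂ (new , from (~-preserves-≡ e~e' d~d') e'≡d') })

  run-transport : ∀ {q q' f g w w'} → WordsRelated _~_ w w' → RegsRelated _~_ f g →
                  Run 𝒜 q f w q' → Run 𝒜 q g w' q'
  run-transport [] f~g done = done
  run-transport ((refl , d~d') ∷ w~w') f~g (step t t∈Δ src≡ lab≡ en run) =
    step t t∈Δ src≡ lab≡ (enabled-related t d~d' f~g en)
      (run-transport w~w' (update-related t d~d' f~g) run)

_≈_ : {D : Set} {m : ℕ} → Regs D m → Regs D m → Set
f ≈ g = ∀ r e → f r e ⇔ g r e

≈-sym : ∀ {D m} {f g : Regs D m} → f ≈ g → g ≈ f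
≈-sym f≈g r e = ⇔-sym (f≈g r e)

module _ {A D : Set} {m : ℕ} (𝒜 : RsA A m) where

  run-≈ : ∀ {q q' f g w} → f ≈ g → Run 𝒜 q f w q' → Run 𝒜 q g w q'
  run-≈ f≈g = run-transport 𝒜 ≡-preserves-≡ (Pointwise.refl (refl , refl)) λ { r refl → f≈g r _ }
    where
    ≡-preserves-≡ : EqualityPreserving {D} _≡_
    ≡-preserves-≡ refl refl = mk⇔ id id

  run-++⁻ : ∀ (u : Word A D) {q q' f v} → Run 𝒜 q f (u ++ v) q' →
            ∃₂ λ p g → Run 𝒜 p g v q' × (∀ {v'} → Run 𝒜 p g v' q' → Run 𝒜 q f (u ++ v') q')
  run-++⁻ [] run = _ , _ , run , λ run' → run'
  run-++⁻ (_ ∷ u) (step t t∈Δ src≡ lab≡ en run) with p , g , rest , resume ← run-++⁻ u run =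
    p , g , rest , λ run' → step t t∈Δ src≡ lab≡ en (resume run')

-- Closure under union

module _ {A D : Set} where

  ≐-trans : {L K J : Language A D} → L ≐ K → K ≐ J → L ≐ J
  ≐-trans L≐K K≐J w = proj₁ (K≐J w) ∘ proj₁ (L≐K w) , proj₂ (L≐K w) ∘ proj₂ (K≐J w)

  ≐-sym : {L K : Language A D} → L ≐ K → K ≐ L
  ≐-sym L≐K w = proj₂ (L≐K w) , proj₁ (L≐K w)

  ∪L-cong : {L L' K K' : Language A D} → L ≐ L' → K ≐ K' → (L ∪L K) ≐ (L' ∪L K')
  ∪L-cong L≐L' K≐K' w =
    (λ { (inj₁ x) → inj₁ (proj₁ (L≐L' w) x) ; (inj₂ y) → inj₂ (proj₁ (K≐K' w) y) }) ,
    (λ { (inj₁ x) → inj₁ (proj₂ (L≐L' w) x) ; (inj₂ y) → inj₂ (proj₂ (K≐K' w) y) })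

module _ {A : Set} where

  widen-trans : ∀ {nq m} → Trans A nq m → Trans A nq (suc m)
  widen-trans t = record
    { src = src t ; lab = lab t ; gin = outside ∷ gin t ; gout = outside ∷ gout t
    ; disj = λ { zero () ; (suc r) (there r∈) (there r∈') → disj t r r∈ r∈' }
    ; up = λ { zero → ⊥ ; (suc r) → outside ∷ up t r }
    ; upIn = λ { zero → false ; (suc r) → upIn t r }
    ; tgt = tgt t }

  widen : ∀ {m} → RsA A m → RsA A (suc m)
  widen 𝒜 = record { nq = nq 𝒜 ; Δ = map widen-trans (Δ 𝒜) ; I = I 𝒜 ; F = F 𝒜 }

  pad : ∀ {m n} → m ≤′ n → RsA A m → RsA A n
  pad ≤′-refl 𝒜 = 𝒜
  pad (≤′-step m≤′n) 𝒜 = widen (pad m≤′n 𝒜)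

module _ {A D : Set} {m : ℕ} where

  record Widened (f : Regs D m) (g : Regs D (suc m)) : Set where
    field
      old-registers : ∀ r e → f r e ⇔ g (suc r) e
  open Widened

  module _ {nq : ℕ} (t : Trans A nq m) {f g} (f~g : Widened f g) where

    enabled-widen⁺ : ∀ {d} → Enabled t f d → Enabled (widen-trans t) g d
    enabled-widen⁺ {d} (ins , outs) =
      (λ { zero () ; (suc r) (there r∈) → to (old-registers f~g r d) (ins r r∈) }) ,
      (λ { zero () ; (suc r) (there r∈) → outs r r∈ ∘ from (old-registers f~g r d) })

    enabled-widen⁻ : ∀ {d} → Enabled (widen-trans t) g d → Enabled t f d
    enabled-widen⁻ {d} (ins , outs) =
      (λ r r∈ → from (old-registers f~g r d) (ins (suc r) (there r∈))) ,
      (λ r r∈ → outs (suc r) (there r∈) ∘ to (old-registers f~g r d))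

    update-widen : ∀ d → Widened (update t f d) (update (widen-trans t) g d)
    update-widen d = record { old-registers = λ r e → mk⇔ (old r e) (new r e) }
      where
      old : ∀ r e → update t f d r e → update (widen-trans t) g d (suc r) e
      old r e (inj₁ (s , s∈ , f-s-e)) = inj₁ (suc s , there s∈ , to (old-registers f~g s e) f-s-e)
      old r e (inj₂ stored) = inj₂ stored
      new : ∀ r e → update (widen-trans t) g d (suc r) e → update t f d r e
      new r e (inj₁ (zero , () , _))
      new r e (inj₁ (suc s , there s∈ , g-s-e)) = inj₁ (s , s∈ , from (old-registers f~g s e) g-s-e)
      new r e (inj₂ stored) = inj₂ stored

  module _ (𝒜 : RsA A m) where

    run-widen⁺ : ∀ {q q' f g w} → Widened f g → Run 𝒜 q f w q' → Run (widen 𝒜) q g w q'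
    run-widen⁺ f~g done = done
    run-widen⁺ f~g (step t t∈Δ src≡ lab≡ en run) =
      step (widen-trans t) (∈-map⁺ widen-trans t∈Δ) src≡ lab≡ (enabled-widen⁺ t f~g en)
        (run-widen⁺ (update-widen t f~g _) run)

    run-widen⁻ : ∀ {q q' f g w} → Widened f g → Run (widen 𝒜) q g w q' → Run 𝒜 q f w q'
    run-widen⁻ f~g done = done
    run-widen⁻ f~g (step _ t'∈Δ src≡ lab≡ en run) with t , t∈Δ , refl ← ∈-map⁻ widen-trans t'∈Δ =
      step t t∈Δ src≡ lab≡ (enabled-widen⁻ t f~g en) (run-widen⁻ (update-widen t f~g _) run)

    lang-widen : Lang D (widen 𝒜) ≐ Lang D 𝒜
    lang-widen w =
      (λ (q , q∈I , q' , q'∈F , run) → q , q∈I , q' , q'∈F , run-widen⁻ empty run) ,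
      (λ (q , q∈I , q' , q'∈F , run) → q , q∈I , q' , q'∈F , run-widen⁺ empty run)
      where
      empty : Widened emptyRegs emptyRegs
      empty = record { old-registers = λ r e → mk⇔ (λ ()) (λ ()) }

lang-pad : ∀ {A D m n} (m≤′n : m ≤′ n) (𝒜 : RsA A m) → Lang D (pad m≤′n 𝒜) ≐ Lang D 𝒜
lang-pad ≤′-refl 𝒜 w = id , id
lang-pad (≤′-step m≤′n) 𝒜 = ≐-trans (lang-widen (pad m≤′n 𝒜)) (lang-pad m≤′n 𝒜)

module _ {A : Set} {m : ℕ} where

  relabel : ∀ {nq nq'} → (Fin nq → Fin nq') → Trans A nq m → Trans A nq' m
  relabel ι t = record
    { src = ι (src t) ; lab = lab t ; gin = gin t ; gout = gout t ; disj = disj t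
    ; up = up t ; upIn = upIn t ; tgt = ι (tgt t) }

  _∪A_ : RsA A m → RsA A m → RsA A m
  𝒜 ∪A ℬ = record
    { nq = nq 𝒜 + nq ℬ
    ; Δ = map (relabel (_↑ˡ nq ℬ)) (Δ 𝒜) ++ map (relabel (nq 𝒜 ↑ʳ_)) (Δ ℬ)
    ; I = I 𝒜 ++ᵛ I ℬ
    ; F = F 𝒜 ++ᵛ F ℬ }

module _ {A D : Set} {m : ℕ} (𝒜 ℬ : RsA A m) (ι : Fin (nq 𝒜) → Fin (nq ℬ)) where

  run-relabel⁺ : (∀ {t} → t ∈ₗ Δ 𝒜 → relabel ι t ∈ₗ Δ ℬ) →
                 ∀ {q q' f w} → Run {D = D} 𝒜 q f w q' → Run ℬ (ι q) f w (ι q')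
  run-relabel⁺ embed done = done
  run-relabel⁺ embed (step t t∈Δ refl lab≡ en run) =
    step (relabel ι t) (embed t∈Δ) refl lab≡ en (run-relabel⁺ embed run)

  run-relabel⁻ : Injective _≡_ _≡_ ι →
                 (∀ {t' q} → t' ∈ₗ Δ ℬ → src t' ≡ ι q → ∃ λ t → t ∈ₗ Δ 𝒜 × t' ≡ relabel ι t) →
                 ∀ {q p f w} → Run {D = D} ℬ (ι q) f w p → ∃ λ q' → p ≡ ι q' × Run 𝒜 q f w q'
  run-relabel⁻ ι-injective reflect done = _ , refl , done
  run-relabel⁻ ι-injective reflect (step _ t'∈Δ src≡ lab≡ en run)
    with t , t∈Δ , refl ← reflect t'∈Δ src≡
    with q' , refl , run' ← run-relabel⁻ ι-injective reflect run =
    q' , refl , step t t∈Δ (ι-injective src≡) lab≡ en run'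

↑ˡ≢↑ʳ : ∀ {a b} (i : Fin a) (j : Fin b) → i ↑ˡ b ≢ a ↑ʳ j
↑ˡ≢↑ʳ {a} {b} i j eq
  with trans (sym (splitAt-↑ˡ a i b)) (trans (cong (splitAt a) eq) (splitAt-↑ʳ a b j))
... | ()

data Side (a b : ℕ) : Fin (a + b) → Set where
  left : ∀ i → Side a b (i ↑ˡ b)
  right : ∀ j → Side a b (a ↑ʳ j)

side : ∀ a b q → Side a b q
side a b q with splitAt a q in eq
... | inj₁ i = subst (Side a b) (splitAt⁻¹-↑ˡ eq) (left i)
... | inj₂ j = subst (Side a b) (splitAt⁻¹-↑ʳ eq) (right j)

↑ˡ∈++⇔∈ : ∀ {a b} (p : Subset a) (q : Subset b) i → i ↑ˡ b ∈ p ++ᵛ q ⇔ i ∈ p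
↑ˡ∈++⇔∈ p q i = mk⇔
  (λ i∈ → lookup⇒[]= i p (trans (sym (lookup-++ˡ p q i)) ([]=⇒lookup i∈)))
  (λ i∈ → lookup⇒[]= _ (p ++ᵛ q) (trans (lookup-++ˡ p q i) ([]=⇒lookup i∈)))

↑ʳ∈++⇔∈ : ∀ {a b} (p : Subset a) (q : Subset b) j → a ↑ʳ j ∈ p ++ᵛ q ⇔ j ∈ q
↑ʳ∈++⇔∈ p q j = mk⇔
  (λ j∈ → lookup⇒[]= j q (trans (sym (lookup-++ʳ p q j)) ([]=⇒lookup j∈)))
  (λ j∈ → lookup⇒[]= _ (p ++ᵛ q) (trans (lookup-++ʳ p q j) ([]=⇒lookup j∈)))

module _ {A D : Set} {m : ℕ} (𝒜 ℬ : RsA A m) where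

  private
    inl : Fin (nq 𝒜) → Fin (nq (𝒜 ∪A ℬ))
    inl = _↑ˡ nq ℬ
    inr : Fin (nq ℬ) → Fin (nq (𝒜 ∪A ℬ))
    inr = nq 𝒜 ↑ʳ_

    reflect-left : ∀ {t' q} → t' ∈ₗ Δ (𝒜 ∪A ℬ) → src t' ≡ inl q →
                   ∃ λ t → t ∈ₗ Δ 𝒜 × t' ≡ relabel inl t
    reflect-left t'∈Δ src≡ with ∈-++⁻ (map (relabel inl) (Δ 𝒜)) t'∈Δ
    ... | inj₁ t'∈ = ∈-map⁻ (relabel inl) t'∈
    ... | inj₂ t'∈ with t , _ , refl ← ∈-map⁻ (relabel inr) t'∈ =
      contradiction (sym src≡) (↑ˡ≢↑ʳ _ _)

    reflect-right : ∀ {t' q} → t' ∈ₗ Δ (𝒜 ∪A ℬ) → src t' ≡ inr q →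
                    ∃ λ t → t ∈ₗ Δ ℬ × t' ≡ relabel inr t
    reflect-right t'∈Δ src≡ with ∈-++⁻ (map (relabel inl) (Δ 𝒜)) t'∈Δ
    ... | inj₂ t'∈ = ∈-map⁻ (relabel inr) t'∈
    ... | inj₁ t'∈ with t , _ , refl ← ∈-map⁻ (relabel inl) t'∈ =
      contradiction src≡ (↑ˡ≢↑ʳ _ _)

  lang-∪A : Lang D (𝒜 ∪A ℬ) ≐ (Lang D 𝒜 ∪L Lang D ℬ)
  lang-∪A w = split , merge
    where
    split : Lang D (𝒜 ∪A ℬ) w → (Lang D 𝒜 ∪L Lang D ℬ) w
    split (q , q∈I , p , p∈F , run) with side (nq 𝒜) (nq ℬ) q
    ... | left i
      with q' , refl , run' ← run-relabel⁻ 𝒜 (𝒜 ∪A ℬ) inl (↑ˡ-injective _ _ _) reflect-left run =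
      inj₁ (i , to (↑ˡ∈++⇔∈ (I 𝒜) (I ℬ) i) q∈I , q' , to (↑ˡ∈++⇔∈ (F 𝒜) (F ℬ) q') p∈F , run')
    ... | right j
      with q' , refl , run' ← run-relabel⁻ ℬ (𝒜 ∪A ℬ) inr (↑ʳ-injective _ _ _) reflect-right run =
      inj₂ (j , to (↑ʳ∈++⇔∈ (I 𝒜) (I ℬ) j) q∈I , q' , to (↑ʳ∈++⇔∈ (F 𝒜) (F ℬ) q') p∈F , run')
    merge : (Lang D 𝒜 ∪L Lang D ℬ) w → Lang D (𝒜 ∪A ℬ) w
    merge (inj₁ (q , q∈I , q' , q'∈F , run)) =
      inl q , from (↑ˡ∈++⇔∈ (I 𝒜) (I ℬ) q) q∈I , inl q' , from (↑ˡ∈++⇔∈ (F 𝒜) (F ℬ) q') q'∈F ,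
      run-relabel⁺ 𝒜 (𝒜 ∪A ℬ) inl (∈-++⁺ˡ ∘ ∈-map⁺ (relabel inl)) run
    merge (inj₂ (q , q∈I , q' , q'∈F , run)) =
      inr q , from (↑ʳ∈++⇔∈ (I 𝒜) (I ℬ) q) q∈I , inr q' , from (↑ʳ∈++⇔∈ (F 𝒜) (F ℬ) q') q'∈F ,
      run-relabel⁺ ℬ (𝒜 ∪A ℬ) inr (∈-++⁺ʳ _ ∘ ∈-map⁺ (relabel inr)) run

∪-closed : ∀ {A D} n (L K : Language A D) → AcceptedLeq D n L → AcceptedLeq D n K →
           AcceptedLeq D n (L ∪L K)
∪-closed n L K (m₁ , m₁≤n , 𝒜 , L≐𝒜) (m₂ , m₂≤n , ℬ , K≐ℬ) =
  n , ≤-refl , 𝒜′ ∪A ℬ′ ,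
  ≐-trans (∪L-cong (≐-trans L≐𝒜 (≐-sym (lang-pad (≤⇒≤′ m₁≤n) 𝒜)))
                   (≐-trans K≐ℬ (≐-sym (lang-pad (≤⇒≤′ m₂≤n) ℬ))))
          (≐-sym (lang-∪A 𝒜′ ℬ′))
  where
  𝒜′ ℬ′ : RsA _ n
  𝒜′ = pad (≤⇒≤′ m₁≤n) 𝒜
  ℬ′ = pad (≤⇒≤′ m₂≤n) ℬ

-- Swapping indistinguishable data

¬¬-pull : ∀ {n} {P : Fin n → Set} → (∀ i → ¬ ¬ P i) → ¬ ¬ (∀ i → P i)
¬¬-pull {zero} _ k = k λ ()
¬¬-pull {suc n} ¬¬P k = ¬¬P zero λ p₀ → ¬¬-pull (¬¬P ∘ suc) λ ps → k (∀-cons p₀ ps)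

indicator : {P : Set} → Dec P → Fin 2
indicator (yes _) = suc zero
indicator (no _) = zero

indicator-injective : {P Q : Set} (P? : Dec P) (Q? : Dec Q) → indicator P? ≡ indicator Q? → P ⇔ Q
indicator-injective (yes p) (yes q) _ = mk⇔ (const q) (const p)
indicator-injective (no ¬p) (no ¬q) _ = mk⇔ (λ p → contradiction p ¬p) (λ q → contradiction q ¬q)
indicator-injective (yes _) (no _) ()
indicator-injective (no _) (yes _) ()

funToFin-injective : ∀ {m n} {f g : Fin m → Fin n} → funToFin f ≡ funToFin g → ∀ i → f i ≡ g i
funToFin-injective {f = f} {g} eq i =
  trans (sym (finToFun-funToFin f i)) (trans (cong (λ c → finToFun c i) eq) (finToFun-funToFin g i))

funToFin-cong : ∀ {m n} {f g : Fin m → Fin n} → (∀ i → f i ≡ g i) → funToFin f ≡ funToFin g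
funToFin-cong {zero} _ = refl
funToFin-cong {suc m} f≗g = cong₂ combine (f≗g zero) (funToFin-cong (f≗g ∘ suc))

-- Register contents are arbitrary propositions, so a collision is only found under double
-- negation; this suffices, as it is used to refute acceptance.
¬¬-pigeonhole : ∀ {m M} (P : Fin m → ℕ → Set) → 2 ^ m < M →
                ¬ ¬ (∃₂ λ i j → i < j × j < M × ∀ r → P r i ⇔ P r j)
¬¬-pigeonhole {m} {M} P 2^m<M = ¬¬-map collide (¬¬-pull λ l → ¬¬-pull λ r → ¬¬-excluded-middle)
  where
  collide : ((l : Fin M) (r : Fin m) → Dec (P r (toℕ l))) →
            ∃₂ λ i j → i < j × j < M × ∀ r → P r i ⇔ P r j
  collide P? with i , j , i<j , same ← pigeonhole 2^m<M (λ l → funToFin (indicator ∘ P? l)) =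
    toℕ i , toℕ j , i<j , toℕ<n j ,
    λ r → indicator-injective (P? i r) (P? j r) (funToFin-injective same r)

transpose : ℕ → ℕ → ℕ → ℕ
transpose i j x with x ≟ i | x ≟ j
... | yes _ | _ = j
... | no _ | yes _ = i
... | no _ | no _ = x

transpose-matchˡ : ∀ i j → transpose i j i ≡ j
transpose-matchˡ i j with i ≟ i
... | yes _ = refl
... | no i≢i = contradiction refl i≢i

transpose-matchʳ : ∀ i j → transpose i j j ≡ i
transpose-matchʳ i j with j ≟ i | j ≟ j
... | yes j≡i | _ = j≡i
... | no _ | yes _ = refl
... | no _ | no j≢j = contradiction refl j≢j

transpose-mismatch : ∀ {i j x} → x ≢ i → x ≢ j → transpose i j x ≡ x
transpose-mismatch {i} {j} {x} x≢i x≢j with x ≟ i | x ≟ j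
... | yes x≡i | _ = contradiction x≡i x≢i
... | no _ | yes x≡j = contradiction x≡j x≢j
... | no _ | no _ = refl

transpose-involutive : ∀ i j x → transpose i j (transpose i j x) ≡ x
transpose-involutive i j x with x ≟ i | x ≟ j
... | yes refl | _ = transpose-matchʳ x j
... | no _ | yes refl = transpose-matchˡ i x
... | no x≢i | no x≢j = transpose-mismatch x≢i x≢j

transpose-injective : ∀ i j → Injective _≡_ _≡_ (transpose i j)
transpose-injective i j {x} {y} eq =
  trans (sym (transpose-involutive i j x))
        (trans (cong (transpose i j) eq) (transpose-involutive i j y))

transpose-⇔ : ∀ (P : ℕ → Set) {i j} → P i ⇔ P j → ∀ x → P x ⇔ P (transpose i j x)
transpose-⇔ P {i} {j} Pi⇔Pj x with x ≟ i | x ≟ j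
... | yes refl | _ = Pi⇔Pj
... | no _ | yes refl = ⇔-sym Pi⇔Pj
... | no _ | no _ = ⇔-id (P x)

positions : ℕ → ℕ → List ℕ
positions = iterate suc

∈-positions⁺ : ∀ {k len x} → k ≤ x → x < k + len → x ∈ₗ positions k len
∈-positions⁺ {k} {zero} {x} k≤x x<k+0 = contradiction (subst (x <_) (+-identityʳ k) x<k+0) (≤⇒≯ k≤x)
∈-positions⁺ {k} {suc len} {x} k≤x x<k+1+len with k ≟ x
... | yes refl = here refl
... | no k≢x = there (∈-positions⁺ (≤∧≢⇒< k≤x k≢x) (subst (x <_) (+-suc k len) x<k+1+len))

∈-positions⁻ : ∀ {k len x} → x ∈ₗ positions k len → x < k + len
∈-positions⁻ {k} {suc len} (here refl) = m<m+n k z<s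
∈-positions⁻ {k} {suc len} {x} (there x∈) = subst (x <_) (sym (+-suc k len)) (∈-positions⁻ x∈)

module DataWords {A D : Set} (a : A) (h : ℕ → D) (h-injective : Injective _≡_ _≡_ h) where

  letters : (ℕ → ℕ) → List ℕ → Word A D
  letters ρ = map (λ x → a , h (ρ x))

  word : ℕ → (ℕ → ℕ) → Word A D
  word M ρ = letters id (positions 0 M) ++ letters ρ (positions 0 M)

  Renamed : (ℕ → ℕ) → D → D → Set
  Renamed σ d d' = ∃ λ x → d ≡ h x × d' ≡ h (σ x)

  renamed-preserves-≡ : ∀ {σ} → Injective _≡_ _≡_ σ → EqualityPreserving (Renamed σ)
  renamed-preserves-≡ {σ} σ-injective (x , refl , refl) (y , refl , refl) =
    mk⇔ (cong (h ∘ σ) ∘ h-injective) (cong h ∘ σ-injective ∘ h-injective)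

  letters-renamed : ∀ σ ρ xs → WordsRelated (Renamed σ) (letters ρ xs) (letters (σ ∘ ρ) xs)
  letters-renamed σ ρ xs = Pointwise.map⁺ _ _ (Pointwise.refl λ {x} → refl , ρ x , refl , refl)

  swap-indistinguishable :
    ∀ {m M} (𝒜 : RsA A m) → 2 ^ m < M → ∀ u ρ xs → Lang D 𝒜 (u ++ letters ρ xs) →
    ¬ ¬ (∃₂ λ i j → i < j × j < M × Lang D 𝒜 (u ++ letters (transpose i j ∘ ρ) xs))
  swap-indistinguishable {M = M} 𝒜 2^m<M u ρ xs (q , q∈I , q' , q'∈F , run)
    with p , g , rest , resume ← run-++⁻ 𝒜 u run =
    ¬¬-map swap (¬¬-pigeonhole (λ r l → g r (h l)) 2^m<M)
    where
    swap : (∃₂ λ i j → i < j × j < M × ∀ r → g r (h i) ⇔ g r (h j)) →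
           ∃₂ λ i j → i < j × j < M × Lang D 𝒜 (u ++ letters (transpose i j ∘ ρ) xs)
    swap (i , j , i<j , j<M , same) =
      i , j , i<j , j<M , q , q∈I , q' , q'∈F ,
      resume (run-transport 𝒜 (renamed-preserves-≡ (transpose-injective i j))
                (letters-renamed (transpose i j) ρ xs)
                (λ { r (x , refl , refl) → transpose-⇔ (λ l → g r (h l)) (same r) x })
                rest)

  swap-sensitive⇒¬accepted :
    ∀ n (L : Language A D) → L (word (suc (2 ^ n)) id) →
    (∀ {i j} → i < j → j < suc (2 ^ n) → ¬ L (word (suc (2 ^ n)) (transpose i j))) →
    ¬ AcceptedLeq D n L
  swap-sensitive⇒¬accepted n L identity∈L swaps∉L (m , m≤n , 𝒜 , L≐𝒜) =
    swap-indistinguishable 𝒜 (s≤s (^-monoʳ-≤ 2 m≤n)) (letters id (positions 0 (suc (2 ^ n)))) id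
      (positions 0 (suc (2 ^ n))) (proj₁ (L≐𝒜 _) identity∈L)
      λ (i , j , i<j , j<M , accepted) → swaps∉L i<j j<M (proj₂ (L≐𝒜 _) accepted)

-- Automata comparing a word with a colouring

Separates : ∀ {n} → Fin n → Subset n → Subset n → Set
Separates b p q = (b ∈ p × b ∉ q) ⊎ (b ∉ p × b ∈ q)

separates-suc : ∀ {n x b} {p q : Subset n} → Separates b p q → Separates (suc b) (x ∷ p) (x ∷ q)
separates-suc (inj₁ (b∈p , b∉q)) = inj₁ (there b∈p , λ { (there b∈q) → b∉q b∈q })
separates-suc (inj₂ (b∉p , b∈q)) = inj₂ ((λ { (there b∈p) → b∉p b∈p }) , there b∈q)

separating : ∀ {n} (p q : Subset n) → p ≢ q → ∃ λ b → Separates b p q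
separating [] [] p≢q = contradiction refl p≢q
separating (true ∷ p) (false ∷ q) _ = zero , inj₁ (here , λ ())
separating (false ∷ p) (true ∷ q) _ = zero , inj₂ ((λ ()) , here)
separating (true ∷ p) (true ∷ q) p≢q with b , separates ← separating p q (p≢q ∘ cong (true ∷_)) =
  suc b , separates-suc separates
separating (false ∷ p) (false ∷ q) p≢q with b , separates ← separating p q (p≢q ∘ cong (false ∷_)) =
  suc b , separates-suc separates

data Mode : Set where
  verify refute : Mode

module ColourAutomata {A D : Set} (a : A) (h : ℕ → D) (h-injective : Injective _≡_ _≡_ h)
                      {n : ℕ} (colour : ℕ → Subset n) (M : ℕ) where

  open DataWords a h h-injective

  -- State k < M reads position k of the first half, state k + M checks position k of the second
  -- half, M + M is the final state of verify and sink = M + M + 1 that of refute.  After the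
  -- first half, register r holds exactly the data h l with r ∈ colour l.
  states : ℕ
  states = suc (suc (M + M))

  st : ℕ → Fin states
  st k = k mod states

  sink : ℕ
  sink = suc (M + M)

  toℕ-st : ∀ {k} → k < states → toℕ (st k) ≡ k
  toℕ-st k<states = trans (toℕ-fromℕ< _) (m<n⇒m%n≡m k<states)

  st-injective : ∀ {i j} → i < states → j < states → st i ≡ st j → i ≡ j
  st-injective i< j< eq = trans (sym (toℕ-st i<)) (trans (cong toℕ eq) (toℕ-st j<))

  st-≢ : ∀ {i j} → i < states → j < states → i ≢ j → st i ≢ st j
  st-≢ i< j< i≢j = i≢j ∘ st-injective i< j<

  phase₂-bound : ∀ {k} → k ≤ M → k + M < states
  phase₂-bound k≤M = m<n⇒m<1+n (s≤s (+-monoˡ-≤ M k≤M))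

  phase₁-bound : ∀ {k} → k < M → k < states
  phase₁-bound k<M = <-≤-trans k<M (<⇒≤ (phase₂-bound {0} z≤n))

  sink-bound : sink < states
  sink-bound = n<1+n sink

  phase₁-injective : ∀ {i k} → i < M → k < M → st i ≡ st k → i ≡ k
  phase₁-injective i<M k<M = st-injective (phase₁-bound i<M) (phase₁-bound k<M)

  phase₂-injective : ∀ {i k} → i ≤ M → k ≤ M → st (i + M) ≡ st (k + M) → i ≡ k
  phase₂-injective {i} {k} i≤M k≤M =
    +-cancelʳ-≡ M i k ∘ st-injective (phase₂-bound i≤M) (phase₂-bound k≤M)

  phase₁≢phase₂ : ∀ {i k} → i < M → k ≤ M → st i ≢ st (k + M)
  phase₁≢phase₂ {i} {k} i<M k≤M =
    st-≢ (phase₁-bound i<M) (phase₂-bound k≤M) (<⇒≢ (<-≤-trans i<M (m≤n+m M k)))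

  phase₁≢sink : ∀ {i} → i < M → st i ≢ st sink
  phase₁≢sink i<M =
    st-≢ (phase₁-bound i<M) sink-bound (<⇒≢ (<-≤-trans i<M (≤-trans (m≤m+n M M) (n≤1+n _))))

  phase₂≢sink : ∀ {k} → k ≤ M → st (k + M) ≢ st sink
  phase₂≢sink k≤M = st-≢ (phase₂-bound k≤M) sink-bound (<⇒≢ (s≤s (+-monoˡ-≤ M k≤M)))

  move : (i j : ℕ) (gin gout : Subset n) → (∀ r → r ∈ gin → r ∉ gout) → (Fin n → Bool) →
         Trans A states n
  move i j gin gout disj adds = record
    { src = st i ; lab = a ; gin = gin ; gout = gout ; disj = disj
    ; up = ⁅_⁆ ; upIn = adds ; tgt = st j }

  unguarded : ∀ (r : Fin n) → r ∈ ⊥ → r ∉ ⊥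
  unguarded _ r∈⊥ _ = ∉⊥ r∈⊥

  store : ℕ → Trans A states n
  store k = move k (suc k) ⊥ ⊥ unguarded (lookup (colour k))

  check : ℕ → Trans A states n
  check k =
    move (k + M) (suc k + M) (colour k) (∁ (colour k)) (λ _ r∈ r∈∁ → x∈∁p⇒x∉p r∈∁ r∈) (const false)

  skip : ℕ → Trans A states n
  skip k = move (k + M) (suc k + M) ⊥ ⊥ unguarded (const false)

  mismatch : ℕ → Fin n → Trans A states n
  mismatch k b = move (k + M) sink (⁅ b ⁆ ∩ ∁ (colour k)) (⁅ b ⁆ ∩ colour k) disjoint (const false)
    where
    disjoint : ∀ r → r ∈ ⁅ b ⁆ ∩ ∁ (colour k) → r ∉ ⁅ b ⁆ ∩ colour k
    disjoint _ r∈ r∈' = x∈∁p⇒x∉p (proj₂ (x∈p∩q⁻ _ _ r∈)) (proj₂ (x∈p∩q⁻ _ _ r∈'))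

  loop : Trans A states n
  loop = move sink sink ⊥ ⊥ unguarded (const false)

  phase₂ : Mode → List (Trans A states n)
  phase₂ verify = map check (positions 0 M)
  phase₂ refute =
    map skip (positions 0 M) ++ cartesianProductWith mismatch (positions 0 M) (allFin n) ++ loop ∷ []

  final : Mode → Fin states
  final verify = st (M + M)
  final refute = st sink

  automaton : Mode → RsA A n
  automaton μ = record
    { nq = states ; Δ = map store (positions 0 M) ++ phase₂ μ ; I = ⁅ st 0 ⁆ ; F = ⁅ final μ ⁆ }

  position-bound : ∀ {x} → x ∈ₗ positions 0 M → x < M
  position-bound = ∈-positions⁻ {0} {M}

  data Step : Mode → Trans A states n → Set where
    storing : ∀ {μ k} → k < M → Step μ (store k)
    checking : ∀ {k} → k < M → Step verify (check k)
    skipping : ∀ {k} → k < M → Step refute (skip k)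
    mismatching : ∀ {k} b → k < M → Step refute (mismatch k b)
    looping : Step refute loop

  phase₂-step : ∀ μ {t} → t ∈ₗ phase₂ μ → Step μ t
  phase₂-step verify t∈ with k , k∈ , refl ← ∈-map⁻ check t∈ = checking (position-bound k∈)
  phase₂-step refute t∈ with ∈-++⁻ (map skip (positions 0 M)) t∈
  ... | inj₁ t∈skips with k , k∈ , refl ← ∈-map⁻ skip t∈skips = skipping (position-bound k∈)
  ... | inj₂ t∈rest with ∈-++⁻ (cartesianProductWith mismatch (positions 0 M) (allFin n)) t∈rest
  ...   | inj₁ t∈mismatches
          with k , b , k∈ , _ , refl ←
               ∈-cartesianProductWith⁻ mismatch (positions 0 M) (allFin n) t∈mismatches =
          mismatching b (position-bound k∈)
  ...   | inj₂ (here refl) = looping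

  step-view : ∀ μ {t} → t ∈ₗ Δ (automaton μ) → Step μ t
  step-view μ t∈Δ with ∈-++⁻ (map store (positions 0 M)) t∈Δ
  ... | inj₁ t∈stores with k , k∈ , refl ← ∈-map⁻ store t∈stores = storing (position-bound k∈)
  ... | inj₂ t∈phase₂ = phase₂-step μ t∈phase₂

  Stored : ℕ → Regs D n
  Stored k r e = ∃ λ l → l < k × r ∈ colour l × e ≡ h l

  stored-nothing : Stored 0 ≈ emptyRegs
  stored-nothing r e = mk⇔ (λ ()) (λ ())

  stored-at : ∀ {k x r} → x < k → Stored k r (h x) ⇔ r ∈ colour x
  stored-at {r = r} x<k = mk⇔
    (λ (l , _ , r∈ , hx≡hl) → subst (λ l → r ∈ colour l) (sym (h-injective hx≡hl)) r∈)
    (λ r∈ → _ , x<k , r∈ , refl)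

  update-keeping : ∀ (t : Trans A states n) → (∀ r → up t r ≡ ⁅ r ⁆) → ∀ {f : Regs D n} {d} r e →
                   update t f d r e ⇔ (f r e ⊎ (upIn t r ≡ true × e ≡ d))
  update-keeping t keeps {f} r e = mk⇔
    (λ { (inj₁ (s , s∈ , f-s-e)) →
           inj₁ (subst (λ s → f s e) (x∈⁅y⁆⇒x≡y r (subst (s ∈_) (keeps r) s∈)) f-s-e)
       ; (inj₂ stored) → inj₂ stored })
    (λ { (inj₁ f-r-e) → inj₁ (r , subst (r ∈_) (sym (keeps r)) (x∈⁅x⁆ r) , f-r-e)
       ; (inj₂ stored) → inj₂ stored })

  update-idle : ∀ (t : Trans A states n) → (∀ r → up t r ≡ ⁅ r ⁆) → (∀ r → upIn t r ≡ false) →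
                ∀ {f : Regs D n} {d} → update t f d ≈ f
  update-idle t keeps idle {f} {d} r e =
    mk⇔ (kept ∘ to keeping) (from keeping ∘ inj₁)
    where
    keeping : update t f d r e ⇔ (f r e ⊎ (upIn t r ≡ true × e ≡ d))
    keeping = update-keeping t keeps {f} r e
    kept : f r e ⊎ (upIn t r ≡ true × e ≡ d) → f r e
    kept (inj₁ f-r-e) = f-r-e
    kept (inj₂ (stored , _)) = contradiction (trans (sym (idle r)) stored) λ ()

  check-idle : ∀ k {f : Regs D n} {d} → update (check k) f d ≈ f
  check-idle k = update-idle (check k) (λ _ → refl) (λ _ → refl)

  skip-idle : ∀ k {f : Regs D n} {d} → update (skip k) f d ≈ f
  skip-idle k = update-idle (skip k) (λ _ → refl) (λ _ → refl)

  update-store : ∀ k → update (store k) (Stored k) (h k) ≈ Stored (suc k)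
  update-store k r e = mk⇔ (grow ∘ to keeping) (from keeping ∘ split)
    where
    keeping : update (store k) (Stored k) (h k) r e ⇔
              (Stored k r e ⊎ (lookup (colour k) r ≡ true × e ≡ h k))
    keeping = update-keeping (store k) (λ _ → refl) {Stored k} r e
    grow : Stored k r e ⊎ (lookup (colour k) r ≡ true × e ≡ h k) → Stored (suc k) r e
    grow (inj₁ (l , l<k , r∈ , e≡)) = l , m<n⇒m<1+n l<k , r∈ , e≡
    grow (inj₂ (stored , e≡)) = k , n<1+n k , lookup⇒[]= r _ stored , e≡
    split : Stored (suc k) r e → Stored k r e ⊎ (lookup (colour k) r ≡ true × e ≡ h k)
    split (l , s≤s l≤k , r∈ , e≡) with l ≟ k
    ... | yes refl = inj₂ ([]=⇒lookup r∈ , e≡)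
    ... | no l≢k = inj₁ (l , ≤∧≢⇒< l≤k l≢k , r∈ , e≡)

  -- This is Enabled t f d, unfolded, for any t with empty guards.
  unguarded-enabled : ∀ {P : Fin n → Set} → (∀ r → r ∈ ⊥ → P r) × (∀ r → r ∈ ⊥ → ¬ P r)
  unguarded-enabled = (λ _ r∈⊥ → contradiction r∈⊥ ∉⊥) , (λ _ r∈⊥ _ → ∉⊥ r∈⊥)

  check-enabled : ∀ {k x} → x < M → Enabled (check k) (Stored M) (h x) ⇔ colour k ≡ colour x
  check-enabled {k} {x} x<M = mk⇔
    (λ (ins , outs) → ⊆-antisym (λ r∈ → to (stored-at x<M) (ins _ r∈))
      (λ {r} r∈ → decidable-stable (r ∈? colour k) λ r∉ →
                    outs r (x∉p⇒x∈∁p r∉) (from (stored-at x<M) r∈)))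
    (λ same → (λ r r∈ → from (stored-at x<M) (subst (r ∈_) same r∈)) ,
              (λ r r∈∁ → x∈∁p⇒x∉p r∈∁ ∘ subst (r ∈_) (sym same) ∘ to (stored-at x<M)))

  mismatch-enabled : ∀ {k x b} → x < M →
                     Enabled (mismatch k b) (Stored M) (h x) ⇔ Separates b (colour k) (colour x)
  mismatch-enabled {k} {x} {b} x<M = mk⇔ separated enabled
    where
    b∈⁅b⁆∩ : ∀ {p} → b ∈ p → b ∈ ⁅ b ⁆ ∩ p
    b∈⁅b⁆∩ b∈p = x∈p∩q⁺ (x∈⁅x⁆ b , b∈p)
    is-b : ∀ {r p} → r ∈ ⁅ b ⁆ ∩ p → r ≡ b
    is-b r∈ = x∈⁅y⁆⇒x≡y b (proj₁ (x∈p∩q⁻ _ _ r∈))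
    separated : Enabled (mismatch k b) (Stored M) (h x) → Separates b (colour k) (colour x)
    separated (ins , outs) with b ∈? colour k
    ... | yes b∈ = inj₁ (b∈ , outs b (b∈⁅b⁆∩ b∈) ∘ from (stored-at x<M))
    ... | no b∉ = inj₂ (b∉ , to (stored-at x<M) (ins b (b∈⁅b⁆∩ (x∉p⇒x∈∁p b∉))))
    enabled : Separates b (colour k) (colour x) → Enabled (mismatch k b) (Stored M) (h x)
    enabled (inj₁ (b∈ , b∉)) =
      (λ r r∈ → contradiction b∈
                  (x∈∁p⇒x∉p (subst (_∈ ∁ (colour k)) (is-b r∈) (proj₂ (x∈p∩q⁻ _ _ r∈))))) ,
      (λ r r∈ stored → b∉ (subst (_∈ colour x) (is-b r∈) (to (stored-at x<M) stored)))
    enabled (inj₂ (b∉ , b∈)) =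
      (λ r r∈ → subst (λ r → Stored M r (h x)) (sym (is-b r∈)) (from (stored-at x<M) b∈)) ,
      (λ r r∈ _ → b∉ (subst (_∈ colour k) (is-b r∈) (proj₂ (x∈p∩q⁻ _ _ r∈))))

  position< : ∀ {k len} → k + suc len ≡ M → k < M
  position< {k} eq = subst (k <_) eq (m<m+n k z<s)

  next-position : ∀ {k len} → k + suc len ≡ M → suc k + len ≡ M
  next-position {k} {len} eq = trans (sym (+-suc k len)) eq

  last-position : ∀ {k} → k + 0 ≡ M → k ≡ M
  last-position {k} eq = trans (sym (+-identityʳ k)) eq

  store∈ : ∀ {μ k} → k < M → store k ∈ₗ Δ (automaton μ)
  store∈ k<M = ∈-++⁺ˡ (∈-map⁺ store (∈-positions⁺ z≤n k<M))

  check∈ : ∀ {k} → k < M → check k ∈ₗ Δ (automaton verify)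
  check∈ k<M = ∈-++⁺ʳ (map store (positions 0 M)) (∈-map⁺ check (∈-positions⁺ z≤n k<M))

  skip∈ : ∀ {k} → k < M → skip k ∈ₗ Δ (automaton refute)
  skip∈ k<M = ∈-++⁺ʳ (map store (positions 0 M)) (∈-++⁺ˡ (∈-map⁺ skip (∈-positions⁺ z≤n k<M)))

  mismatch∈ : ∀ {k} b → k < M → mismatch k b ∈ₗ Δ (automaton refute)
  mismatch∈ b k<M = ∈-++⁺ʳ (map store (positions 0 M)) (∈-++⁺ʳ (map skip (positions 0 M)) (∈-++⁺ˡ
    (∈-cartesianProductWith⁺ mismatch (∈-positions⁺ z≤n k<M) (∈-allFin b))))

  loop∈ : loop ∈ₗ Δ (automaton refute)
  loop∈ = ∈-++⁺ʳ (map store (positions 0 M)) (∈-++⁺ʳ (map skip (positions 0 M))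
    (∈-++⁺ʳ (cartesianProductWith mismatch (positions 0 M) (allFin n)) (here refl)))

  read-prefix⁺ : ∀ μ len k {v q} → k + len ≡ M → Run (automaton μ) (st M) (Stored M) v q →
                 Run (automaton μ) (st k) (Stored k) (letters id (positions k len) ++ v) q
  read-prefix⁺ μ zero k k+0≡M run with refl ← last-position k+0≡M = run
  read-prefix⁺ μ (suc len) k eq run =
    step (store k) (store∈ {μ} (position< eq)) refl refl unguarded-enabled
      (run-≈ _ (≈-sym (update-store k)) (read-prefix⁺ μ len (suc k) (next-position eq) run))

  read-prefix⁻ : ∀ μ len k {v q} → k + len ≡ M →
                 Run (automaton μ) (st k) (Stored k) (letters id (positions k len) ++ v) q →
                 Run (automaton μ) (st M) (Stored M) v q
  read-prefix⁻ μ zero k k+0≡M run with refl ← last-position k+0≡M = run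
  read-prefix⁻ μ (suc len) k eq (step t t∈Δ src≡ _ _ run) with step-view μ t∈Δ
  ... | storing i<M with refl ← phase₁-injective i<M (position< eq) src≡ =
    read-prefix⁻ μ len (suc k) (next-position eq) (run-≈ _ (update-store k) run)
  ... | checking i<M = contradiction (sym src≡) (phase₁≢phase₂ (position< eq) (<⇒≤ i<M))
  ... | skipping i<M = contradiction (sym src≡) (phase₁≢phase₂ (position< eq) (<⇒≤ i<M))
  ... | mismatching _ i<M = contradiction (sym src≡) (phase₁≢phase₂ (position< eq) (<⇒≤ i<M))
  ... | looping = contradiction (sym src≡) (phase₁≢sink (position< eq))

  verify⁺ : ∀ {ρ} len k → k + len ≡ M →
            All (λ x → ρ x < M × colour x ≡ colour (ρ x)) (positions k len) →
            Run (automaton verify) (st (k + M)) (Stored M) (letters ρ (positions k len)) (st (M + M))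
  verify⁺ zero k k+0≡M [] with refl ← last-position k+0≡M = done
  verify⁺ (suc len) k eq ((ρk<M , same) ∷ rest) =
    step (check k) (check∈ (position< eq)) refl refl (from (check-enabled {k} ρk<M) same)
      (run-≈ _ (≈-sym (check-idle k))
        (verify⁺ len (suc k) (next-position eq) rest))

  verify⁻ : ∀ {ρ} len k {q} → k + len ≡ M →
            Run (automaton verify) (st (k + M)) (Stored M) (letters ρ (positions k len)) q →
            All (λ x → ρ x < M → colour x ≡ colour (ρ x)) (positions k len)
  verify⁻ zero k _ _ = []
  verify⁻ (suc len) k eq (step t t∈Δ src≡ _ en run) with step-view verify t∈Δ
  ... | storing i<M = contradiction src≡ (phase₁≢phase₂ i<M (<⇒≤ (position< eq)))
  ... | checking {i} i<M with refl ← phase₂-injective (<⇒≤ i<M) (<⇒≤ (position< eq)) src≡ =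
    (λ ρk<M → to (check-enabled {k} ρk<M) en) ∷
    verify⁻ len (suc k) (next-position eq) (run-≈ _ (check-idle k) run)

  loop-run : ∀ {ρ} xs {f} → Run (automaton refute) (st sink) f (letters ρ xs) (st sink)
  loop-run [] = done
  loop-run (x ∷ xs) = step loop loop∈ refl refl unguarded-enabled (loop-run xs)

  refute⁺ : ∀ {ρ} len k → k + len ≡ M →
            Any (λ x → ρ x < M × ∃ λ b → Separates b (colour x) (colour (ρ x))) (positions k len) →
            Run (automaton refute) (st (k + M)) (Stored M) (letters ρ (positions k len)) (st sink)
  refute⁺ (suc len) k eq (here (ρk<M , b , separates)) =
    step (mismatch k b) (mismatch∈ b (position< eq)) refl refl
      (from (mismatch-enabled {k} ρk<M) separates)
      (loop-run (positions (suc k) len))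
  refute⁺ (suc len) k eq (there later) =
    step (skip k) (skip∈ (position< eq)) refl refl unguarded-enabled
      (run-≈ _ (≈-sym (skip-idle k))
        (refute⁺ len (suc k) (next-position eq) later))

  refute⁻ : ∀ len k {q} → k + len ≡ M →
            Run (automaton refute) (st (k + M)) (Stored M) (letters id (positions k len)) q →
            q ≢ st sink
  refute⁻ zero k k+0≡M done with refl ← last-position k+0≡M = phase₂≢sink ≤-refl
  refute⁻ (suc len) k eq (step t t∈Δ src≡ _ en run) with step-view refute t∈Δ
  ... | storing i<M = contradiction src≡ (phase₁≢phase₂ i<M (<⇒≤ (position< eq)))
  ... | skipping i<M with refl ← phase₂-injective (<⇒≤ i<M) (<⇒≤ (position< eq)) src≡ =
    refute⁻ len (suc k) (next-position eq) (run-≈ _ (skip-idle k) run)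
  ... | mismatching b i<M with refl ← phase₂-injective (<⇒≤ i<M) (<⇒≤ (position< eq)) src≡ =
    contradiction (to (mismatch-enabled {k} (position< eq)) en) λ
      { (inj₁ (b∈ , b∉)) → b∉ b∈ ; (inj₂ (b∉ , b∈)) → b∉ b∈ }
  ... | looping = contradiction src≡ (≢-sym (phase₂≢sink (<⇒≤ (position< eq))))

  verify-accepts-identity : Lang D (automaton verify) (word M id)
  verify-accepts-identity = st 0 , x∈⁅x⁆ _ , st (M + M) , x∈⁅x⁆ _ ,
    run-≈ _ stored-nothing (read-prefix⁺ verify M 0 refl
      (verify⁺ M 0 refl (All.tabulate λ x∈ → position-bound x∈ , refl)))

  verify-respects-colours : ∀ {ρ x} → Lang D (automaton verify) (word M ρ) → x < M → ρ x < M →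
                            colour x ≡ colour (ρ x)
  verify-respects-colours (q , q∈I , _ , _ , run) x<M ρx<M with refl ← x∈⁅y⁆⇒x≡y (st 0) q∈I =
    All.lookup (verify⁻ M 0 refl (read-prefix⁻ verify M 0 refl (run-≈ _ (≈-sym stored-nothing) run)))
      (∈-positions⁺ z≤n x<M) ρx<M

  refute-rejects-identity : ¬ Lang D (automaton refute) (word M id)
  refute-rejects-identity (q , q∈I , q' , q'∈F , run) with refl ← x∈⁅y⁆⇒x≡y (st 0) q∈I =
    refute⁻ M 0 refl (read-prefix⁻ refute M 0 refl (run-≈ _ (≈-sym stored-nothing) run))
      (x∈⁅y⁆⇒x≡y (st sink) q'∈F)

  refute-accepts : ∀ {ρ x b} → x < M → ρ x < M → Separates b (colour x) (colour (ρ x)) →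
                   Lang D (automaton refute) (word M ρ)
  refute-accepts x<M ρx<M separates = st 0 , x∈⁅x⁆ _ , st sink , x∈⁅x⁆ _ ,
    run-≈ _ stored-nothing (read-prefix⁺ refute M 0 refl
      (refute⁺ M 0 refl (Any.map (λ { refl → ρx<M , _ , separates }) (∈-positions⁺ z≤n x<M))))

  verify-swap : ∀ {i j} → i < j → j < M → Lang D (automaton verify) (word M (transpose i j)) →
                colour i ≡ colour j
  verify-swap {i} {j} i<j j<M accepted =
    trans (verify-respects-colours accepted (<-trans i<j j<M)
             (subst (_< M) (sym (transpose-matchˡ i j)) j<M))
          (cong colour (transpose-matchˡ i j))

  refute-swap : ∀ {i j b} → i < j → j < M → Separates b (colour i) (colour j) →
                Lang D (automaton refute) (word M (transpose i j))
  refute-swap {i} {j} i<j j<M separates =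
    refute-accepts (<-trans i<j j<M) (subst (_< M) (sym (transpose-matchˡ i j)) j<M)
      (subst (λ l → Separates _ (colour i) (colour l)) (sym (transpose-matchˡ i j)) separates)

-- Counterexamples

bit : Fin 2 → Bool
bit zero = false
bit (suc zero) = true

bit-injective : ∀ {x y} → bit x ≡ bit y → x ≡ y
bit-injective {zero} {zero} _ = refl
bit-injective {suc zero} {suc zero} _ = refl
bit-injective {zero} {suc zero} ()
bit-injective {suc zero} {zero} ()

residue : ∀ n → ℕ → Fin (2 ^ n)
residue n l = _mod_ l (2 ^ n) ⦃ m^n≢0 2 n ⦄

toℕ-residue : ∀ {n l} → l < 2 ^ n → toℕ (residue n l) ≡ l
toℕ-residue {n} l< = trans (toℕ-fromℕ< _) (m<n⇒m%n≡m ⦃ m^n≢0 2 n ⦄ l<)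

binary : (n : ℕ) → ℕ → Subset n
binary n l = tabulate (bit ∘ finToFun (residue n l))

binary-injective : ∀ {n i j} → i < 2 ^ n → j < 2 ^ n → binary n i ≡ binary n j → i ≡ j
binary-injective {n} {i} {j} i< j< eq =
  trans (sym (toℕ-residue {n} i<)) (trans (cong toℕ same-residue) (toℕ-residue {n} j<))
  where
  same-bits : ∀ r → finToFun (residue n i) r ≡ finToFun (residue n j) r
  same-bits r = bit-injective
    (trans (sym (lookup∘tabulate _ r)) (trans (cong (λ v → lookup v r) eq) (lookup∘tabulate _ r)))
  same-residue : residue n i ≡ residue n j
  same-residue = trans (sym (funToFin-finToFin {n} {2} (residue n i)))
                       (trans (funToFin-cong same-bits) (funToFin-finToFin {n} {2} (residue n j)))

high : (n : ℕ) → ℕ → Subset n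
high n l = replicate n (2 ^ n ≤ᵇ l)

colours-differ : ∀ n {i j} → i < j → j < suc (2 ^ suc n) →
                 binary (suc n) i ≢ binary (suc n) j ⊎ high (suc n) i ≢ high (suc n) j
colours-differ n {i} {j} i<j (s≤s j≤2^n) with m≤n⇒m<n∨m≡n j≤2^n
... | inj₁ j<2^n = inj₁ (<⇒≢ i<j ∘ binary-injective (<-trans i<j j<2^n) j<2^n)
... | inj₂ refl = inj₂ λ eq →
  <⇒≱ i<j (≤ᵇ⇒≤ _ i (subst T (sym (cong head eq)) (≤⇒≤ᵇ {2 ^ suc n} ≤-refl)))

lang-accepted : ∀ {A D m n} (𝒜 : RsA A m) → m ≤ n → AcceptedLeq D n (Lang D 𝒜)
lang-accepted 𝒜 m≤n = _ , m≤n , 𝒜 , λ w → id , id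

module Counterexamples {A D : Set} (a : A) (h : ℕ → D) (h-injective : Injective _≡_ _≡_ h)
                       (n : ℕ) where

  open DataWords a h h-injective

  private
    M : ℕ
    M = suc (2 ^ suc n)
    module Binary = ColourAutomata a h h-injective (binary (suc n)) M
    module High = ColourAutomata a h h-injective (high (suc n)) M

  ∩-not-closed : ∃₂ λ (L K : Language A D) → AcceptedLeq D (suc n) L × AcceptedLeq D (suc n) K ×
                   ¬ AcceptedLeq D (suc n) (L ∩L K)
  ∩-not-closed =
    Lang D (Binary.automaton verify) , Lang D (High.automaton verify) ,
    lang-accepted _ ≤-refl , lang-accepted _ ≤-refl ,
    swap-sensitive⇒¬accepted (suc n) _
      (Binary.verify-accepts-identity , High.verify-accepts-identity) swaps∉
    where
    swaps∉ : ∀ {i j} → i < j → j < M →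
             ¬ (Lang D (Binary.automaton verify) ∩L Lang D (High.automaton verify))
                 (word M (transpose i j))
    swaps∉ i<j j<M (∈binary , ∈high) with colours-differ n i<j j<M
    ... | inj₁ differ = differ (Binary.verify-swap i<j j<M ∈binary)
    ... | inj₂ differ = differ (High.verify-swap i<j j<M ∈high)

  ∁-not-closed : ∃ λ (L : Language A D) → AcceptedLeq D (suc n) L × ¬ AcceptedLeq D (suc n) (∁L L)
  ∁-not-closed =
    refuted , ∪-closed (suc n) _ _ (lang-accepted _ ≤-refl) (lang-accepted _ ≤-refl) ,
    swap-sensitive⇒¬accepted (suc n) (∁L refuted)
      [ Binary.refute-rejects-identity , High.refute-rejects-identity ]′ swaps∉
    where
    refuted : Language A D
    refuted = Lang D (Binary.automaton refute) ∪L Lang D (High.automaton refute)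
    swaps∉ : ∀ {i j} → i < j → j < M → ¬ ∁L refuted (word M (transpose i j))
    swaps∉ i<j j<M ∉refuted with colours-differ n i<j j<M
    ... | inj₁ differ = ∉refuted (inj₁ (Binary.refute-swap i<j j<M (proj₂ (separating _ _ differ))))
    ... | inj₂ differ = ∉refuted (inj₂ (High.refute-swap i<j j<M (proj₂ (separating _ _ differ))))

theorem4p4 : (A D : Set) (k : ℕ) → A ↔ Fin (suc k) → ℕ ↣ D →
    (n : ℕ) → 1 ≤ n →
      ((L K : Language A D) → AcceptedLeq D n L → AcceptedLeq D n K →
        AcceptedLeq D n (L ∪L K))
      × (∃₂ λ (L K : Language A D) → AcceptedLeq D n L × AcceptedLeq D n K ×
          ¬ AcceptedLeq D n (L ∩L K))
      × (∃ λ (L : Language A D) → AcceptedLeq D n L × ¬ AcceptedLeq D n (∁L L))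
theorem4p4 A D k A↔Fin ℕ↣D (suc n) _ = ∪-closed (suc n) , ∩-not-closed , ∁-not-closed
  where
  open Counterexamples (Inverse.from A↔Fin zero) (Injection.to ℕ↣D) (Injection.injective ℕ↣D) n
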